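{- Let $G$ be a graph of order $n\ge 3$. Then: (a) If $\Delta(G)\le\sqrt{2n}$, then $G$ has distinct vertices $u,v$ with $\mathrm{Tri}_G(u)=\mathrm{Tri}_G(v)$. (b) If $\delta(G)>n-1-(2n/3)^{1/3}$, then $G$ has two distinct vertices $u,v$ with $d_G(u)=d_G(v)$ and $\mathrm{Tri}_G(u)=\mathrm{Tri}_G(v)$. (c) If $G$ is $d$-regular and triangle-distinct, then $\sqrt{2n}<d\le n-\sqrt{2n/3}$.
   Context: All graphs are finite and simple. $\Delta(G)$ and $\delta(G)$ are the maximum and minimum degree of $G$, and $d_G(u)$ is the degree of $u$. $\mathrm{Tri}_G(u)$ (the triangle-degree of $u$) is the number of triangles of $G$ containing $u$. A graph is triangle-distinct if it has at least two vertices and the triangle-degrees of its vertices are pairwise distinct. -}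

module Defs where

open import Data.Nat using (ℕ; _⊔_; _⊓_; _<ᵇ_)
open import Data.Bool using (Bool; true; false; _∧_)
open import Data.Fin using (Fin; toℕ)
open import Data.List using (List; length; filterᵇ; foldr; allFin; cartesianProduct)
open import Data.Product using (_×_; _,_)
open import Relation.Binary.PropositionalEquality using (_≡_)

record Graph (n : ℕ) : Set where
  field
    Adj    : Fin n → Fin n → Bool
    sym    : ∀ u v → Adj u v ≡ Adj v u
    irrefl : ∀ u → Adj u u ≡ false
open Graph public

deg : ∀ {n} → Graph n → Fin n → ℕ
deg {n} G u = length (filterᵇ (Adj G u) (allFin n))

Tri : ∀ {n} → Graph n → Fin n → ℕ
Tri {n} G u = length (filterᵇ isTri (cartesianProduct (allFin n) (allFin n)))
  where
  isTri : Fin n × Fin n → Bool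
  isTri (v , w) = (toℕ v <ᵇ toℕ w) ∧ Adj G u v ∧ Adj G u w ∧ Adj G v w

-- Δ(G): maximum degree (0 for the empty vertex set)
maxDeg : ∀ {n} → Graph n → ℕ
maxDeg {n} G = foldr (λ u m → deg G u ⊔ m) 0 (allFin n)

-- δ(G): minimum degree. The fold starts from n, which exceeds every degree
-- (degrees are ≤ n - 1), so for n ≥ 1 this is exactly the minimum degree.
minDeg : ∀ {n} → Graph n → ℕ
minDeg {n} G = foldr (λ u m → deg G u ⊓ m) n (allFin n)

-- For a vertex u call a non-edge {v , w} of G outer if v and w are not both neighbours of u.
-- Counting ordered pairs of neighbours of u gives d(u)² = d(u) + 2 Tri(u) + 2 i(u), where
-- i(u) is the number of non-edges inside N(u); since the non-edges split into the i(u) inner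
-- and the o(u) outer ones, Tri(u) is determined by d(u) and o(u). The n − 1 − d(u) non-edges at u
-- are outer, and every outer non-edge meets u or a non-neighbour of u, so
-- n − 1 − d(u) ≤ o(u) ≤ (n − 1 − d(u)) k when all non-degrees are at most k.
-- (a) Tri(u) ≤ (d² − d)/2 < n − 1 when d² ≤ 2n, so pigeonhole applies to Tri.
-- (b) With k = n − 1 − δ the pair (n − 1 − d(u), o(u)) takes at most (k³ + k + 2)/2 < n values.
-- (c) (a) forces d² > 2n; for d-regular G, o(u) ≤ k² with k = n − 1 − d, and o must be
--     injective, so n ≤ k² + 1.
module Submission where

open import Data.Bool using (Bool; true; false; _∧_; not)
open import Data.Bool.Properties using (T?; ∧-assoc; ∧-comm; ∧-idem; ∧-zeroʳ; ∧-identityʳ)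
open import Data.Empty using (⊥-elim)
open import Data.Fin using (Fin; toℕ; fromℕ<)
open import Data.Fin.Properties using (_≟_; toℕ-injective; pigeonhole) renaming (<⇒≢ to <⇒≢ᶠ)
open import Data.List
  using (List; []; _∷_; _++_; foldr; map; length; filterᵇ; tabulate; cartesianProduct; applyUpTo; upTo; lookup)
open import Data.List.Membership.Propositional using (_∈_)
open import Data.List.Membership.Propositional.Properties
  using (∈-upTo⁺; ∈-allFin; ∈-map⁺; ∈-++⁺ˡ; ∈-++⁺ʳ; ∈-applyUpTo⁺)
open import Data.List.Properties using (length-++; length-map; length-applyUpTo; length-upTo; filter-++; map-tabulate)
open import Data.List.Relation.Unary.Any using (index; here; there)
open import Data.List.Relation.Unary.Any.Properties using (lookup-index)
open import Data.Nat using (ℕ; zero; suc; _+_; _*_; _∸_; _^_; _⊔_; _⊓_; _≤_; _<_; _<ᵇ_; z≤n; s≤s; s≤s⁻¹; z<s)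
open import Data.Nat.Properties renaming (_≟_ to _≟ℕ_)
open import Data.Nat.Tactic.RingSolver using (solve-∀)
open import Data.Product using (_×_; _,_; Σ-syntax; proj₁; proj₂)
open import Defs hiding (sym)
open import Function using (_∘_; id)
open import Function.Definitions using (Injective)
open import Relation.Binary.PropositionalEquality
open import Relation.Nullary using (¬_; does; yes; no)
open import Relation.Nullary.Decidable using (dec-true; dec-false)
open import Relation.Nullary.Reflects using (ofʸ; ofⁿ)
open import Algebra.Properties.Semiring.Sum +-*-semiring
  using (sum; sum-syntax; sum-cong-≗; ∑-distrib-+; ∑-comm; *-distribˡ-sum; *-distribʳ-sum; sum-replicate-zero)

⟦_⟧ : Bool → ℕ
⟦ true ⟧ = 1
⟦ false ⟧ = 0

⟦∧⟧ : ∀ b c → ⟦ b ∧ c ⟧ ≡ ⟦ b ⟧ * ⟦ c ⟧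
⟦∧⟧ false c = refl
⟦∧⟧ true c = sym (+-identityʳ ⟦ c ⟧)

⟦⟧-idem : ∀ b → ⟦ b ⟧ * ⟦ b ⟧ ≡ ⟦ b ⟧
⟦⟧-idem false = refl
⟦⟧-idem true = refl

⟦⟧+⟦not⟧ : ∀ b → ⟦ b ⟧ + ⟦ not b ⟧ ≡ 1
⟦⟧+⟦not⟧ false = refl
⟦⟧+⟦not⟧ true = refl

⟦not-∧⟧≤ : ∀ b c → ⟦ not (b ∧ c) ⟧ ≤ ⟦ not b ⟧ + ⟦ not c ⟧
⟦not-∧⟧≤ false c = s≤s z≤n
⟦not-∧⟧≤ true c = ≤-refl

δ : ∀ {n} → Fin n → Fin n → ℕ
δ v w = ⟦ does (v ≟ w) ⟧

does-≟-sym : ∀ {n} (v w : Fin n) → does (v ≟ w) ≡ does (w ≟ v)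
does-≟-sym v w with v ≟ w | w ≟ v
... | yes _    | yes _    = refl
... | no _     | no _     = refl
... | yes refl | no w≢v   = ⊥-elim (w≢v refl)
... | no v≢w   | yes refl = ⊥-elim (v≢w refl)

lt : ∀ {n} → Fin n → Fin n → ℕ
lt v w = ⟦ toℕ v <ᵇ toℕ w ⟧

m+m≡2*m : ∀ m → m + m ≡ 2 * m
m+m≡2*m m = cong (m +_) (sym (+-identityʳ m))

∑1≡n : ∀ n → ∑[ i < n ] 1 ≡ n
∑1≡n zero = refl
∑1≡n (suc n) = cong suc (∑1≡n n)

∑-δ : ∀ {n} (v : Fin n) (f : Fin n → ℕ) → ∑[ w < n ] (δ v w * f w) ≡ f v
∑-δ {suc n} Fin.zero f =
  trans (cong₂ _+_ (+-identityʳ (f Fin.zero)) (sum-replicate-zero n)) (+-identityʳ (f Fin.zero))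
∑-δ {suc n} (Fin.suc v) f = ∑-δ v (f ∘ Fin.suc)

∑-mono-≤ : ∀ {n} {f g : Fin n → ℕ} → (∀ i → f i ≤ g i) → sum f ≤ sum g
∑-mono-≤ {zero} f≤g = z≤n
∑-mono-≤ {suc n} f≤g = +-mono-≤ (f≤g Fin.zero) (∑-mono-≤ (f≤g ∘ Fin.suc))

∑∑ : ∀ {n} → (Fin n → Fin n → ℕ) → ℕ
∑∑ {n} h = ∑[ v < n ] ∑[ w < n ] h v w

∑∑-cong : ∀ {n} {g h : Fin n → Fin n → ℕ} → (∀ v w → g v w ≡ h v w) → ∑∑ g ≡ ∑∑ h
∑∑-cong g≡h = sum-cong-≗ (λ v → sum-cong-≗ (g≡h v))

∑∑-mono-≤ : ∀ {n} {g h : Fin n → Fin n → ℕ} → (∀ v w → g v w ≤ h v w) → ∑∑ g ≤ ∑∑ h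
∑∑-mono-≤ g≤h = ∑-mono-≤ (λ v → ∑-mono-≤ (g≤h v))

∑∑-distrib-+ : ∀ {n} (g h : Fin n → Fin n → ℕ) → ∑∑ (λ v w → g v w + h v w) ≡ ∑∑ g + ∑∑ h
∑∑-distrib-+ {n} g h =
  trans (sum-cong-≗ (λ v → ∑-distrib-+ (g v) (h v))) (∑-distrib-+ (λ v → sum (g v)) (λ v → sum (h v)))

Symmetric : ∀ {n} → (Fin n → Fin n → ℕ) → Set
Symmetric h = ∀ v w → h v w ≡ h w v

∑∑≡2*∑∑< : ∀ {n} (h : Fin n → Fin n → ℕ) → Symmetric h → (∀ v → h v v ≡ 0) →
  ∑∑ h ≡ 2 * ∑∑ (λ v w → lt v w * h v w)
∑∑≡2*∑∑< h h-sym h-diag = begin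
  ∑∑ h                                                   ≡⟨ ∑∑-cong split ⟩
  ∑∑ (λ v w → lt v w * h v w + lt w v * h w v)           ≡⟨ ∑∑-distrib-+ h< (λ v w → h< w v) ⟩
  ∑∑ h< + ∑∑ (λ v w → h< w v)                            ≡⟨ cong (∑∑ h< +_) (∑-comm (λ v w → h< w v)) ⟩
  ∑∑ h< + ∑∑ h<                                          ≡⟨ m+m≡2*m (∑∑ h<) ⟩
  2 * ∑∑ h<                                              ∎
  where
  open ≡-Reasoning
  h< = λ v w → lt v w * h v w
  split : ∀ v w → h v w ≡ lt v w * h v w + lt w v * h w v
  split v w with toℕ v <ᵇ toℕ w | <ᵇ-reflects-< (toℕ v) (toℕ w)
               | toℕ w <ᵇ toℕ v | <ᵇ-reflects-< (toℕ w) (toℕ v)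
  ... | true  | ofʸ v<w | true  | ofʸ w<v = ⊥-elim (<-asym v<w w<v)
  ... | true  | _       | false | _       = sym (trans (+-identityʳ _) (+-identityʳ _))
  ... | false | _       | true  | _       = trans (h-sym v w) (sym (+-identityʳ _))
  ... | false | ofⁿ v≮w | false | ofⁿ w≮v
    rewrite toℕ-injective (≤∧≮⇒≡ (≮⇒≥ w≮v) v≮w) = h-diag w

∑∑-weighted-handshake : ∀ {n} (h : Fin n → Fin n → ℕ) → Symmetric h → (χ : Fin n → ℕ) →
  ∑∑ (λ v w → h v w * (χ v + χ w)) ≡ 2 * ∑[ v < n ] (χ v * ∑[ w < n ] h v w)
∑∑-weighted-handshake {n} h h-sym χ = begin
  ∑∑ (λ v w → h v w * (χ v + χ w))                   ≡⟨ ∑∑-cong (λ v w → *-distribˡ-+ (h v w) (χ v) (χ w)) ⟩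
  ∑∑ (λ v w → h v w * χ v + h v w * χ w)             ≡⟨ ∑∑-distrib-+ hχ hχ′ ⟩
  ∑∑ hχ + ∑∑ hχ′                                     ≡⟨ cong (∑∑ hχ +_) (trans (∑-comm hχ′) flip) ⟩
  ∑∑ hχ + ∑∑ hχ                                      ≡⟨ m+m≡2*m (∑∑ hχ) ⟩
  2 * ∑∑ hχ                                          ≡⟨ cong (2 *_) (sum-cong-≗ pull) ⟩
  2 * ∑[ v < n ] (χ v * ∑[ w < n ] h v w)            ∎
  where
  open ≡-Reasoning
  hχ hχ′ : Fin n → Fin n → ℕ
  hχ v w = h v w * χ v
  hχ′ v w = h v w * χ w
  flip : ∑∑ (λ v w → h w v * χ v) ≡ ∑∑ hχ
  flip = ∑∑-cong (λ v w → cong (_* χ v) (h-sym w v))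
  pull : ∀ v → ∑[ w < n ] (h v w * χ v) ≡ χ v * ∑[ w < n ] h v w
  pull v = trans (sum-cong-≗ (λ w → *-comm (h v w) (χ v))) (sym (*-distribˡ-sum (χ v) (h v)))

length-filterᵇ-tabulate : ∀ {a} {A : Set a} {n} (p : A → Bool) (f : Fin n → A) →
  length (filterᵇ p (tabulate f)) ≡ ∑[ i < n ] ⟦ p (f i) ⟧
length-filterᵇ-tabulate {n = zero} p f = refl
length-filterᵇ-tabulate {n = suc n} p f with p (f Fin.zero)
... | true  = cong suc (length-filterᵇ-tabulate p (f ∘ Fin.suc))
... | false = length-filterᵇ-tabulate p (f ∘ Fin.suc)

length-filterᵇ-cartesianProduct : ∀ {a b} {A : Set a} {B : Set b} {m n}
  (p : A × B → Bool) (f : Fin m → A) (g : Fin n → B) →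
  length (filterᵇ p (cartesianProduct (tabulate f) (tabulate g))) ≡ ∑[ i < m ] ∑[ j < n ] ⟦ p (f i , g j) ⟧
length-filterᵇ-cartesianProduct {m = zero} p f g = refl
length-filterᵇ-cartesianProduct {m = suc m} p f g = begin
  length (filterᵇ p (row ++ rest))                  ≡⟨ cong length (filter-++ (T? ∘ p) row rest) ⟩
  length (filterᵇ p row ++ filterᵇ p rest)          ≡⟨ length-++ (filterᵇ p row) ⟩
  length (filterᵇ p row) + length (filterᵇ p rest)
    ≡⟨ cong₂ _+_ count-row (length-filterᵇ-cartesianProduct p (f ∘ Fin.suc) g) ⟩
  ∑[ i < suc m ] ∑[ j < _ ] ⟦ p (f i , g j) ⟧       ∎
  where
  open ≡-Reasoning
  row = map (f Fin.zero ,_) (tabulate g)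
  rest = cartesianProduct (tabulate (f ∘ Fin.suc)) (tabulate g)
  count-row = trans (cong (length ∘ filterᵇ p) (map-tabulate g (f Fin.zero ,_)))
                    (length-filterᵇ-tabulate p (λ j → f Fin.zero , g j))

≤-foldr-⊔ : ∀ {a} {A : Set a} (g : A → ℕ) z {x xs} → x ∈ xs → g x ≤ foldr (λ y m → g y ⊔ m) z xs
≤-foldr-⊔ g z (here refl) = m≤m⊔n (g _) _
≤-foldr-⊔ g z {xs = y ∷ _} (there x∈xs) = ≤-trans (≤-foldr-⊔ g z x∈xs) (m≤n⊔m (g y) _)

foldr-⊓-≤ : ∀ {a} {A : Set a} (g : A → ℕ) z {x xs} → x ∈ xs → foldr (λ y m → g y ⊓ m) z xs ≤ g x
foldr-⊓-≤ g z (here refl) = m⊓n≤m (g _) _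
foldr-⊓-≤ g z {xs = y ∷ _} (there x∈xs) = ≤-trans (m⊓n≤n (g y) _) (foldr-⊓-≤ g z x∈xs)

Collision : ∀ {a} {A : Set a} {n} → (Fin n → A) → Set a
Collision {n = n} f = Σ[ i ∈ Fin n ] Σ[ j ∈ Fin n ] (i ≢ j × f i ≡ f j)

injective⇒¬collision : ∀ {a} {A : Set a} {n} {f : Fin n → A} → Injective _≡_ _≡_ f → ¬ Collision f
injective⇒¬collision f-injective (_ , _ , i≢j , same) = i≢j (f-injective same)

pigeonhole-∈ : ∀ {a} {A : Set a} {n} (f : Fin n → A) (xs : List A) →
  length xs < n → (∀ i → f i ∈ xs) → Collision f
pigeonhole-∈ f xs |xs|<n f∈xs with i , j , i<j , same ← pigeonhole |xs|<n (index ∘ f∈xs) =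
  i , j , <⇒≢ᶠ i<j ,
  trans (lookup-index (f∈xs i)) (trans (cong (lookup xs) same) (sym (lookup-index (f∈xs j))))

pigeonhole-< : ∀ {m n} (f : Fin n → ℕ) → m < n → (∀ i → f i < m) → Collision f
pigeonhole-< {m} f m<n f<m =
  pigeonhole-∈ f (upTo m) (subst (_< _) (sym (length-upTo m)) m<n) (∈-upTo⁺ ∘ f<m)

profiles : ℕ → ℕ → List (ℕ × ℕ)
profiles k zero = []
profiles k (suc j) = map (j ,_) (applyUpTo (j +_) (suc (j * (k ∸ 1)))) ++ profiles k j

∈-profiles : ∀ k {m j t} → j < m → j ≤ t → t ≤ j * k → (j , t) ∈ profiles k m
∈-profiles k {suc m} {j} {t} j<1+m j≤t t≤jk with j ≟ℕ m
... | no j≢m = ∈-++⁺ʳ _ (∈-profiles k (≤∧≢⇒< (s≤s⁻¹ j<1+m) j≢m) j≤t t≤jk)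
... | yes refl = ∈-++⁺ˡ (∈-map⁺ (j ,_) (subst (_∈ applyUpTo (j +_) (suc (j * (k ∸ 1)))) (m+[n∸m]≡n j≤t)
                   (∈-applyUpTo⁺ (j +_) (s≤s t∸j≤j[k∸1]))))
  where
  t∸j≤j[k∸1] : t ∸ j ≤ j * (k ∸ 1)
  t∸j≤j[k∸1] = begin
    t ∸ j           ≤⟨ ∸-monoˡ-≤ j t≤jk ⟩
    j * k ∸ j       ≡˘⟨ cong (j * k ∸_) (*-identityʳ j) ⟩
    j * k ∸ j * 1   ≡˘⟨ *-distribˡ-∸ j k 1 ⟩
    j * (k ∸ 1)     ∎
    where open ≤-Reasoning

length-profiles : ∀ k m → 2 * length (profiles k m) + (k ∸ 1) * m ≡ (k ∸ 1) * (m * m) + 2 * m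
length-profiles k zero = sym (+-identityʳ ((k ∸ 1) * 0))
length-profiles k (suc m) = begin
  2 * length (row ++ profiles k m) + c * suc m                 ≡⟨ cong (λ x → 2 * x + c * suc m) |row++rest| ⟩
  2 * (suc (m * c) + length (profiles k m)) + c * suc m        ≡⟨ regroup (m * c) (length (profiles k m)) c m ⟩
  (2 * length (profiles k m) + c * m) + (2 + 2 * (m * c) + c)  ≡⟨ cong (_+ (2 + 2 * (m * c) + c)) (length-profiles k m) ⟩
  c * (m * m) + 2 * m + (2 + 2 * (m * c) + c)                  ≡⟨ expand c m ⟩
  c * (suc m * suc m) + 2 * suc m                              ∎
  where
  open ≡-Reasoning
  c = k ∸ 1
  row = map (m ,_) (applyUpTo (m +_) (suc (m * c)))
  |row++rest| : length (row ++ profiles k m) ≡ suc (m * c) + length (profiles k m)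
  |row++rest| = trans (length-++ row) (cong (_+ length (profiles k m))
    (trans (length-map (m ,_) (applyUpTo (m +_) (suc (m * c)))) (length-applyUpTo (m +_) (suc (m * c)))))
  regroup : ∀ x l c m → 2 * (suc x + l) + c * suc m ≡ (2 * l + c * m) + (2 + 2 * x + c)
  regroup = solve-∀
  expand : ∀ c m → c * (m * m) + 2 * m + (2 + 2 * (m * c) + c) ≡ c * (suc m * suc m) + 2 * suc m
  expand = solve-∀

cube-slack : ∀ i → 3 * (suc (suc i) * (suc (suc i) * (suc (suc i) * 1))) + suc i * suc (suc (suc i))
  ≡ suc i * (suc (suc (suc i)) * suc (suc (suc i))) + 2 * suc (suc (suc i))
    + (2 * (i * i * i) + 12 * (i * i) + 23 * i + 12)
cube-slack = solve-∀

profiles-fit : ∀ {n} k → 3 ≤ n → 3 * k ^ 3 < 2 * n → length (profiles k (suc k)) < n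
profiles-fit 0 3≤n _ = ≤-trans (s≤s (s≤s z≤n)) 3≤n
profiles-fit 1 3≤n _ = 3≤n
profiles-fit {n} k@(suc (suc j)) _ 3k³<2n = *-cancelˡ-< 2 _ n (≤-<-trans 2L≤3k³ 3k³<2n)
  where
  L = length (profiles k (suc k))
  2L≤3k³ : 2 * L ≤ 3 * k ^ 3
  2L≤3k³ = +-cancelʳ-≤ (suc j * suc k) (2 * L) (3 * k ^ 3) (begin
    2 * L + suc j * suc k                     ≡⟨ length-profiles k (suc k) ⟩
    suc j * (suc k * suc k) + 2 * suc k       ≤⟨ m≤m+n _ _ ⟩
    suc j * (suc k * suc k) + 2 * suc k + _   ≡˘⟨ cube-slack j ⟩
    3 * k ^ 3 + suc j * suc k                 ∎)
    where open ≤-Reasoning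

few-triangles : ∀ {n t d} → 3 ≤ n → 2 * t + d ≤ d * d → d * d ≤ 2 * n → t < n ∸ 1
few-triangles {suc n} {t} {d} 3≤n 2t+d≤d² d²≤2n with d ≤? 2
... | yes d≤2 = ≤-trans (s≤s t≤1) (s≤s⁻¹ 3≤n)
  where
  square≤2+ : ∀ e → e ≤ 2 → e * e ≤ 2 + e
  square≤2+ 0 _ = z≤n
  square≤2+ 1 _ = s≤s z≤n
  square≤2+ 2 _ = ≤-refl
  square≤2+ (suc (suc (suc _))) (s≤s (s≤s ()))
  t≤1 : t ≤ 1
  t≤1 = *-cancelˡ-≤ 2 (+-cancelʳ-≤ d (2 * t) 2 (≤-trans 2t+d≤d² (square≤2+ d d≤2)))
... | no d≰2 = s≤s⁻¹ (*-cancelˡ-< 2 (suc t) (suc n) (begin-strict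
  2 * suc t    ≡⟨ *-suc 2 t ⟩
  2 + 2 * t    <⟨ +-monoˡ-< (2 * t) (≰⇒> d≰2) ⟩
  d + 2 * t    ≡⟨ +-comm d (2 * t) ⟩
  2 * t + d    ≤⟨ 2t+d≤d² ⟩
  d * d        ≤⟨ d²≤2n ⟩
  2 * suc n    ∎))
  where open ≤-Reasoning

m^2≡m*m : ∀ m → m ^ 2 ≡ m * m
m^2≡m*m m = cong (m *_) (*-identityʳ m)

square-slack : ∀ k → 3 * (suc k * (suc k * 1)) ≡ 2 * suc (k * k) + (k * k + 6 * k + 1)
square-slack = solve-∀

module _ {n : ℕ} (G : Graph n) where

  A : Fin n → Fin n → ℕ
  A v w = ⟦ Adj G v w ⟧

  nonadj : Fin n → Fin n → Bool
  nonadj v w = not (Adj G v w) ∧ not (does (v ≟ w))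

  Ā : Fin n → Fin n → ℕ
  Ā v w = ⟦ nonadj v w ⟧

  bothAdj : Fin n → Fin n → Fin n → Bool
  bothAdj u v w = Adj G u v ∧ Adj G u w

  nondeg : Fin n → ℕ
  nondeg u = ∑[ w < n ] Ā u w

  -- A subscript ₂ marks a count of ordered pairs, so every unordered pair is counted twice.
  nonEdges₂ : ℕ
  nonEdges₂ = ∑∑ Ā

  triangles₂ inner₂ outer₂ outer : Fin n → ℕ
  triangles₂ u = ∑∑ (λ v w → ⟦ bothAdj u v w ⟧ * A v w)
  inner₂ u = ∑∑ (λ v w → ⟦ bothAdj u v w ⟧ * Ā v w)
  outer₂ u = ∑∑ (λ v w → ⟦ not (bothAdj u v w) ⟧ * Ā v w)
  outer u = ∑∑ (λ v w → lt v w * (⟦ not (bothAdj u v w) ⟧ * Ā v w))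

  A-sym : Symmetric A
  A-sym v w = cong ⟦_⟧ (Graph.sym G v w)

  Ā-sym : Symmetric Ā
  Ā-sym v w = cong ⟦_⟧ (cong₂ (λ x y → not x ∧ not y) (Graph.sym G v w) (does-≟-sym v w))

  A-diag : ∀ v → A v v ≡ 0
  A-diag v = cong ⟦_⟧ (irrefl G v)

  Ā-diag : ∀ v → Ā v v ≡ 0
  Ā-diag v rewrite dec-true (v ≟ v) refl = cong ⟦_⟧ (∧-zeroʳ _)

  δ+A+Ā≡1 : ∀ v w → δ v w + A v w + Ā v w ≡ 1
  δ+A+Ā≡1 v w with v ≟ w
  ... | yes refl rewrite irrefl G v = refl
  ... | no _ with Adj G v w
  ...   | true  = refl
  ...   | false = refl

  deg≡∑ : ∀ u → deg G u ≡ ∑[ v < n ] A u v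
  deg≡∑ u = length-filterᵇ-tabulate (Adj G u) id

  Tri≡∑ : ∀ u → Tri G u ≡ ∑∑ (λ v w → lt v w * (⟦ bothAdj u v w ⟧ * A v w))
  Tri≡∑ u = trans (length-filterᵇ-cartesianProduct isTri id id) (∑∑-cong summand)
    where
    isTri = λ (v , w) → (toℕ v <ᵇ toℕ w) ∧ Adj G u v ∧ Adj G u w ∧ Adj G v w
    summand : ∀ v w → ⟦ isTri (v , w) ⟧ ≡ lt v w * (⟦ bothAdj u v w ⟧ * A v w)
    summand v w = trans (⟦∧⟧ (toℕ v <ᵇ toℕ w) _) (cong (lt v w *_)
      (trans (cong ⟦_⟧ (sym (∧-assoc (Adj G u v) (Adj G u w) (Adj G v w)))) (⟦∧⟧ (bothAdj u v w) (Adj G v w))))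

  triangles₂≡2*Tri : ∀ u → triangles₂ u ≡ 2 * Tri G u
  triangles₂≡2*Tri u = trans (∑∑≡2*∑∑< _ sym′ diag) (cong (2 *_) (sym (Tri≡∑ u)))
    where
    sym′ : Symmetric (λ v w → ⟦ bothAdj u v w ⟧ * A v w)
    sym′ v w = cong₂ _*_ (cong ⟦_⟧ (∧-comm (Adj G u v) (Adj G u w))) (A-sym v w)
    diag : ∀ v → ⟦ bothAdj u v v ⟧ * A v v ≡ 0
    diag v = trans (cong (⟦ bothAdj u v v ⟧ *_) (A-diag v)) (*-zeroʳ ⟦ bothAdj u v v ⟧)

  outer₂≡2*outer : ∀ u → outer₂ u ≡ 2 * outer u
  outer₂≡2*outer u = ∑∑≡2*∑∑< _ sym′ diag
    where
    sym′ : Symmetric (λ v w → ⟦ not (bothAdj u v w) ⟧ * Ā v w)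
    sym′ v w = cong₂ _*_ (cong (⟦_⟧ ∘ not) (∧-comm (Adj G u v) (Adj G u w))) (Ā-sym v w)
    diag : ∀ v → ⟦ not (bothAdj u v v) ⟧ * Ā v v ≡ 0
    diag v = trans (cong (⟦ not (bothAdj u v v) ⟧ *_) (Ā-diag v)) (*-zeroʳ ⟦ not (bothAdj u v v) ⟧)

  suc[deg+nondeg]≡n : ∀ u → suc (deg G u + nondeg u) ≡ n
  suc[deg+nondeg]≡n u = begin
    suc (deg G u + nondeg u)                                ≡⟨ cong₂ (λ x y → x + y + nondeg u) (sym ∑δ≡1) (deg≡∑ u) ⟩
    ∑[ w < n ] δ u w + ∑[ w < n ] A u w + nondeg u          ≡˘⟨ cong (_+ nondeg u) (∑-distrib-+ (δ u) (A u)) ⟩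
    ∑[ w < n ] (δ u w + A u w) + nondeg u                   ≡˘⟨ ∑-distrib-+ (λ w → δ u w + A u w) (Ā u) ⟩
    ∑[ w < n ] (δ u w + A u w + Ā u w)                      ≡⟨ sum-cong-≗ (δ+A+Ā≡1 u) ⟩
    ∑[ w < n ] 1                                            ≡⟨ ∑1≡n n ⟩
    n                                                       ∎
    where
    open ≡-Reasoning
    ∑δ≡1 : ∑[ w < n ] δ u w ≡ 1
    ∑δ≡1 = trans (sum-cong-≗ (λ w → sym (*-identityʳ (δ u w)))) (∑-δ u (λ _ → 1))

  deg*deg≡deg+triangles₂+inner₂ : ∀ u → deg G u * deg G u ≡ deg G u + triangles₂ u + inner₂ u
  deg*deg≡deg+triangles₂+inner₂ u = begin
    deg G u * deg G u
      ≡⟨ cong (_* deg G u) (deg≡∑ u) ⟩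
    ∑[ v < n ] A u v * deg G u
      ≡⟨ *-distribʳ-sum (deg G u) (A u) ⟩
    ∑[ v < n ] (A u v * deg G u)
      ≡⟨ sum-cong-≗ (λ v → trans (cong (A u v *_) (deg≡∑ u)) (*-distribˡ-sum (A u v) (A u))) ⟩
    ∑∑ (λ v w → A u v * A u w)
      ≡⟨ ∑∑-cong split ⟩
    ∑∑ (λ v w → diagonal v w + triangle v w + inner v w)
      ≡⟨ ∑∑-distrib-+ (λ v w → diagonal v w + triangle v w) inner ⟩
    ∑∑ (λ v w → diagonal v w + triangle v w) + inner₂ u
      ≡⟨ cong (_+ inner₂ u) (∑∑-distrib-+ diagonal triangle) ⟩
    ∑∑ diagonal + triangles₂ u + inner₂ u
      ≡⟨ cong (λ x → x + triangles₂ u + inner₂ u) ∑∑diagonal≡deg ⟩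
    deg G u + triangles₂ u + inner₂ u ∎
    where
    open ≡-Reasoning
    diagonal triangle inner : Fin n → Fin n → ℕ
    diagonal v w = δ v w * ⟦ bothAdj u v w ⟧
    triangle v w = ⟦ bothAdj u v w ⟧ * A v w
    inner v w = ⟦ bothAdj u v w ⟧ * Ā v w
    split : ∀ v w → A u v * A u w ≡ diagonal v w + triangle v w + inner v w
    split v w = begin
      A u v * A u w                          ≡˘⟨ ⟦∧⟧ (Adj G u v) (Adj G u w) ⟩
      b                                      ≡˘⟨ *-identityʳ b ⟩
      b * 1                                  ≡˘⟨ cong (b *_) (δ+A+Ā≡1 v w) ⟩
      b * (δ v w + A v w + Ā v w)            ≡⟨ *-distribˡ-+ b (δ v w + A v w) (Ā v w) ⟩
      b * (δ v w + A v w) + b * Ā v w        ≡⟨ cong (_+ b * Ā v w) (*-distribˡ-+ b (δ v w) (A v w)) ⟩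
      b * δ v w + b * A v w + b * Ā v w      ≡⟨ cong (λ x → x + b * A v w + b * Ā v w) (*-comm b (δ v w)) ⟩
      δ v w * b + b * A v w + b * Ā v w      ∎
      where b = ⟦ bothAdj u v w ⟧
    ∑∑diagonal≡deg : ∑∑ diagonal ≡ deg G u
    ∑∑diagonal≡deg = begin
      ∑∑ diagonal                            ≡⟨ sum-cong-≗ (λ v → ∑-δ v (λ w → ⟦ bothAdj u v w ⟧)) ⟩
      ∑[ v < n ] ⟦ Adj G u v ∧ Adj G u v ⟧   ≡⟨ sum-cong-≗ (λ v → cong ⟦_⟧ (∧-idem (Adj G u v))) ⟩
      ∑[ v < n ] A u v                       ≡˘⟨ deg≡∑ u ⟩
      deg G u                                ∎

  nonEdges₂≡inner₂+outer₂ : ∀ u → nonEdges₂ ≡ inner₂ u + outer₂ u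
  nonEdges₂≡inner₂+outer₂ u = trans (∑∑-cong split) (∑∑-distrib-+ inner outer′)
    where
    open ≡-Reasoning
    inner outer′ : Fin n → Fin n → ℕ
    inner v w = ⟦ bothAdj u v w ⟧ * Ā v w
    outer′ v w = ⟦ not (bothAdj u v w) ⟧ * Ā v w
    split : ∀ v w → Ā v w ≡ inner v w + outer′ v w
    split v w = begin
      Ā v w                                                   ≡˘⟨ +-identityʳ (Ā v w) ⟩
      1 * Ā v w                                               ≡˘⟨ cong (_* Ā v w) (⟦⟧+⟦not⟧ (bothAdj u v w)) ⟩
      (⟦ bothAdj u v w ⟧ + ⟦ not (bothAdj u v w) ⟧) * Ā v w  ≡⟨ *-distribʳ-+ (Ā v w) ⟦ bothAdj u v w ⟧ _ ⟩
      inner v w + outer′ v w                                  ∎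

  outer₂-summand≥ : ∀ u v w → Ā v w * (δ u v + δ u w) ≤ ⟦ not (bothAdj u v w) ⟧ * Ā v w
  outer₂-summand≥ u v w with v ≟ w
  ... | yes refl rewrite irrefl G v = z≤n
  ... | no v≢w with u ≟ v
  ...   | yes refl rewrite dec-false (v ≟ w) v≢w | irrefl G v = ≤-reflexive (*-comm _ 1)
  ...   | no _ with u ≟ w
  ...     | yes refl rewrite irrefl G w | ∧-zeroʳ (Adj G w v) = ≤-reflexive (*-comm _ 1)
  ...     | no _ = ≤-trans (≤-reflexive (*-zeroʳ ⟦ not (Adj G v w) ∧ true ⟧)) z≤n

  -- A non-edge not inside N(u) has an endpoint outside N(u); if that endpoint is u,
  -- the other one is a non-neighbour of u.
  outer₂-summand≤ : ∀ u v w → ⟦ not (bothAdj u v w) ⟧ * Ā v w ≤ Ā v w * (Ā u v + Ā u w)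
  outer₂-summand≤ u v w with v ≟ w
  ... | yes refl rewrite irrefl G v = ≤-trans (≤-reflexive (*-zeroʳ ⟦ not (bothAdj u v v) ⟧)) z≤n
  ... | no v≢w with u ≟ v
  ...   | yes refl rewrite irrefl G v | dec-false (v ≟ w) v≢w =
    ≤-reflexive (trans (+-identityʳ _) (sym (⟦⟧-idem _)))
  ...   | no _ with u ≟ w
  ...     | yes refl rewrite irrefl G w | ∧-zeroʳ (Adj G w v) | Graph.sym G w v =
    ≤-reflexive (trans (+-identityʳ X) (sym (trans (cong (X *_) (+-identityʳ X)) (⟦⟧-idem _))))
    where X = ⟦ not (Adj G v u) ∧ true ⟧
  ...     | no _
    rewrite ∧-identityʳ (not (Adj G v w)) | ∧-identityʳ (not (Adj G u v)) | ∧-identityʳ (not (Adj G u w)) =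
    ≤-trans (≤-reflexive (*-comm ⟦ not (bothAdj u v w) ⟧ _))
            (*-monoʳ-≤ ⟦ not (Adj G v w) ⟧ (⟦not-∧⟧≤ (Adj G u v) (Adj G u w)))

  nondeg≤outer : ∀ u → nondeg u ≤ outer u
  nondeg≤outer u = *-cancelˡ-≤ 2 (begin
    2 * nondeg u                              ≡˘⟨ cong (2 *_) (∑-δ u nondeg) ⟩
    2 * ∑[ v < n ] (δ u v * nondeg v)         ≡˘⟨ ∑∑-weighted-handshake Ā Ā-sym (δ u) ⟩
    ∑∑ (λ v w → Ā v w * (δ u v + δ u w))      ≤⟨ ∑∑-mono-≤ (outer₂-summand≥ u) ⟩
    outer₂ u                                  ≡⟨ outer₂≡2*outer u ⟩
    2 * outer u                               ∎)
    where open ≤-Reasoning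

  outer≤nondeg*k : ∀ {k} → (∀ v → nondeg v ≤ k) → ∀ u → outer u ≤ nondeg u * k
  outer≤nondeg*k {k} nondeg≤k u = *-cancelˡ-≤ 2 (begin
    2 * outer u                               ≡˘⟨ outer₂≡2*outer u ⟩
    outer₂ u                                  ≤⟨ ∑∑-mono-≤ (outer₂-summand≤ u) ⟩
    ∑∑ (λ v w → Ā v w * (Ā u v + Ā u w))      ≡⟨ ∑∑-weighted-handshake Ā Ā-sym (Ā u) ⟩
    2 * ∑[ v < n ] (Ā u v * nondeg v)         ≤⟨ *-monoʳ-≤ 2 (∑-mono-≤ (λ v → *-monoʳ-≤ (Ā u v) (nondeg≤k v))) ⟩
    2 * ∑[ v < n ] (Ā u v * k)                ≡˘⟨ cong (2 *_) (*-distribʳ-sum k (Ā u)) ⟩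
    2 * (nondeg u * k)                        ∎)
    where open ≤-Reasoning

  triangle-identity : ∀ u → deg G u + 2 * Tri G u + nonEdges₂ ≡ deg G u * deg G u + 2 * outer u
  triangle-identity u = begin
    deg G u + 2 * Tri G u + nonEdges₂
      ≡⟨ cong₂ (λ x y → deg G u + x + y) (sym (triangles₂≡2*Tri u)) (nonEdges₂≡inner₂+outer₂ u) ⟩
    deg G u + triangles₂ u + (inner₂ u + outer₂ u)
      ≡˘⟨ +-assoc (deg G u + triangles₂ u) (inner₂ u) (outer₂ u) ⟩
    deg G u + triangles₂ u + inner₂ u + outer₂ u
      ≡⟨ cong₂ _+_ (sym (deg*deg≡deg+triangles₂+inner₂ u)) (outer₂≡2*outer u) ⟩
    deg G u * deg G u + 2 * outer u ∎
    where open ≡-Reasoning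

  2*Tri+deg≤deg*deg : ∀ u → 2 * Tri G u + deg G u ≤ deg G u * deg G u
  2*Tri+deg≤deg*deg u = begin
    2 * Tri G u + deg G u                ≡˘⟨ cong (_+ deg G u) (triangles₂≡2*Tri u) ⟩
    triangles₂ u + deg G u               ≤⟨ m≤m+n (triangles₂ u + deg G u) (inner₂ u) ⟩
    triangles₂ u + deg G u + inner₂ u    ≡⟨ cong (_+ inner₂ u) (+-comm (triangles₂ u) (deg G u)) ⟩
    deg G u + triangles₂ u + inner₂ u    ≡˘⟨ deg*deg≡deg+triangles₂+inner₂ u ⟩
    deg G u * deg G u                    ∎
    where open ≤-Reasoning

  Tri-determined : ∀ u v → deg G u ≡ deg G v → outer u ≡ outer v → Tri G u ≡ Tri G v
  Tri-determined u v deg≡ outer≡ =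
    *-cancelˡ-≡ (Tri G u) (Tri G v) 2 (+-cancelˡ-≡ (deg G u) _ _ (+-cancelʳ-≡ nonEdges₂ _ _ (begin
      deg G u + 2 * Tri G u + nonEdges₂    ≡⟨ triangle-identity u ⟩
      deg G u * deg G u + 2 * outer u      ≡⟨ cong₂ (λ d t → d * d + 2 * t) deg≡ outer≡ ⟩
      deg G v * deg G v + 2 * outer v      ≡˘⟨ triangle-identity v ⟩
      deg G v + 2 * Tri G v + nonEdges₂    ≡˘⟨ cong (λ d → d + 2 * Tri G v + nonEdges₂) deg≡ ⟩
      deg G u + 2 * Tri G v + nonEdges₂    ∎)))
    where open ≡-Reasoning

  deg≡⇒nondeg≡ : ∀ {u v} → deg G u ≡ deg G v → nondeg u ≡ nondeg v
  deg≡⇒nondeg≡ {u} {v} deg≡ = +-cancelˡ-≡ (deg G v) _ _ (suc-injective (begin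
    suc (deg G v + nondeg u)   ≡˘⟨ cong (λ d → suc (d + nondeg u)) deg≡ ⟩
    suc (deg G u + nondeg u)   ≡⟨ suc[deg+nondeg]≡n u ⟩
    n                          ≡˘⟨ suc[deg+nondeg]≡n v ⟩
    suc (deg G v + nondeg v)   ∎))
    where open ≡-Reasoning

  nondeg≡⇒deg≡ : ∀ {u v} → nondeg u ≡ nondeg v → deg G u ≡ deg G v
  nondeg≡⇒deg≡ {u} {v} nondeg≡ = +-cancelʳ-≡ (nondeg v) _ _ (suc-injective (begin
    suc (deg G u + nondeg v)   ≡˘⟨ cong (λ x → suc (deg G u + x)) nondeg≡ ⟩
    suc (deg G u + nondeg u)   ≡⟨ suc[deg+nondeg]≡n u ⟩
    n                          ≡˘⟨ suc[deg+nondeg]≡n v ⟩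
    suc (deg G v + nondeg v)   ∎))
    where open ≡-Reasoning

  nondeg≡n∸1∸deg : ∀ u → nondeg u ≡ (n ∸ 1) ∸ deg G u
  nondeg≡n∸1∸deg u = sym (begin
    (n ∸ 1) ∸ deg G u                          ≡⟨ ∸-+-assoc n 1 (deg G u) ⟩
    n ∸ suc (deg G u)                          ≡˘⟨ cong (_∸ suc (deg G u)) (suc[deg+nondeg]≡n u) ⟩
    suc (deg G u + nondeg u) ∸ suc (deg G u)   ≡⟨ m+n∸m≡n (deg G u) (nondeg u) ⟩
    nondeg u                                   ∎)
    where open ≡-Reasoning

  Tri-collision : 3 ≤ n → (∀ u → deg G u * deg G u ≤ 2 * n) → Collision (Tri G)
  Tri-collision 3≤n small-deg = pigeonhole-< (Tri G) (∸-monoʳ-< z<s (≤-trans z<s 3≤n))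
    (λ u → few-triangles 3≤n (2*Tri+deg≤deg*deg u) (small-deg u))

  deg-Tri-collision : 3 ≤ n → 3 * ((n ∸ 1) ∸ minDeg G) ^ 3 < 2 * n →
    Σ[ u ∈ Fin n ] Σ[ v ∈ Fin n ] (u ≢ v × deg G u ≡ deg G v × Tri G u ≡ Tri G v)
  deg-Tri-collision 3≤n small-k =
    refine (pigeonhole-∈ (λ u → nondeg u , outer u) (profiles k (suc k)) (profiles-fit k 3≤n small-k) profile∈)
    where
    k = (n ∸ 1) ∸ minDeg G
    nondeg≤k : ∀ v → nondeg v ≤ k
    nondeg≤k v = ≤-trans (≤-reflexive (nondeg≡n∸1∸deg v))
      (∸-monoʳ-≤ (n ∸ 1) (foldr-⊓-≤ (deg G) n (∈-allFin v)))
    profile∈ : ∀ u → (nondeg u , outer u) ∈ profiles k (suc k)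
    profile∈ u = ∈-profiles k (s≤s (nondeg≤k u)) (nondeg≤outer u) (outer≤nondeg*k nondeg≤k u)
    refine : Collision (λ u → nondeg u , outer u) →
      Σ[ u ∈ Fin n ] Σ[ v ∈ Fin n ] (u ≢ v × deg G u ≡ deg G v × Tri G u ≡ Tri G v)
    refine (u , v , u≢v , same) = u , v , u≢v , deg≡ , Tri-determined u v deg≡ (cong proj₂ same)
      where deg≡ = nondeg≡⇒deg≡ (cong proj₁ same)

  regular-bounds : 3 ≤ n → (d : ℕ) → (∀ u → deg G u ≡ d) → Injective _≡_ _≡_ (Tri G) →
    2 * n < d ^ 2 × d ≤ n × 2 * n ≤ 3 * (n ∸ d) ^ 2
  regular-bounds 3≤n d regular Tri-injective = 2n<d² , d≤n , 2n≤3[n∸d]²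
    where
    u₀ : Fin n
    u₀ = fromℕ< (≤-trans z<s 3≤n)
    k = nondeg u₀
    suc[d+k]≡n : suc (d + k) ≡ n
    suc[d+k]≡n = trans (cong (λ x → suc (x + k)) (sym (regular u₀))) (suc[deg+nondeg]≡n u₀)

    2n<d² : 2 * n < d ^ 2
    2n<d² = ≰⇒> λ d²≤2n → injective⇒¬collision Tri-injective (Tri-collision 3≤n (λ u →
      subst (λ x → x * x ≤ 2 * n) (sym (regular u)) (subst (_≤ 2 * n) (m^2≡m*m d) d²≤2n)))

    d≤n : d ≤ n
    d≤n = ≤-trans (m≤m+n d k) (≤-trans (n≤1+n (d + k)) (≤-reflexive suc[d+k]≡n))

    outer≤k*k : ∀ v → outer v ≤ k * k
    outer≤k*k v = subst (λ x → outer v ≤ x * k) (nondeg≡k v) (outer≤nondeg*k (≤-reflexive ∘ nondeg≡k) v)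
      where
      nondeg≡k : ∀ v → nondeg v ≡ k
      nondeg≡k v = deg≡⇒nondeg≡ (trans (regular v) (sym (regular u₀)))

    outer-injective : Injective _≡_ _≡_ outer
    outer-injective {u} {v} same = Tri-injective (Tri-determined u v (trans (regular u) (sym (regular v))) same)

    n≤1+k*k : n ≤ suc (k * k)
    n≤1+k*k = ≮⇒≥ λ 1+k*k<n →
      injective⇒¬collision outer-injective (pigeonhole-< outer 1+k*k<n (s≤s ∘ outer≤k*k))

    n∸d≡1+k : n ∸ d ≡ suc k
    n∸d≡1+k = trans (cong (_∸ d) (trans (sym suc[d+k]≡n) (sym (+-suc d k)))) (m+n∸m≡n d (suc k))

    2n≤3[n∸d]² : 2 * n ≤ 3 * (n ∸ d) ^ 2
    2n≤3[n∸d]² = begin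
      2 * n                                    ≤⟨ *-monoʳ-≤ 2 n≤1+k*k ⟩
      2 * suc (k * k)                          ≤⟨ m≤m+n (2 * suc (k * k)) (k * k + 6 * k + 1) ⟩
      2 * suc (k * k) + (k * k + 6 * k + 1)    ≡˘⟨ square-slack k ⟩
      3 * suc k ^ 2                            ≡˘⟨ cong (λ m → 3 * m ^ 2) n∸d≡1+k ⟩
      3 * (n ∸ d) ^ 2                          ∎
      where open ≤-Reasoning

theorem5 : (n : ℕ) → 3 ≤ n → (G : Graph n) →
    ((maxDeg G ^ 2 ≤ 2 * n →
        Σ[ u ∈ Fin n ] Σ[ v ∈ Fin n ] (u ≢ v × Tri G u ≡ Tri G v))
    × (3 * ((n ∸ 1) ∸ minDeg G) ^ 3 < 2 * n →
        Σ[ u ∈ Fin n ] Σ[ v ∈ Fin n ]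
          (u ≢ v × deg G u ≡ deg G v × Tri G u ≡ Tri G v))
    × ((d : ℕ) → (∀ u → deg G u ≡ d) → 2 ≤ n → Injective _≡_ _≡_ (Tri G) →
        (2 * n < d ^ 2 × d ≤ n × 2 * n ≤ 3 * (n ∸ d) ^ 2)))
theorem5 n 3≤n G =
    (λ Δ²≤2n → Tri-collision G 3≤n (λ u →
      ≤-trans (*-mono-≤ (deg≤Δ u) (deg≤Δ u)) (subst (_≤ 2 * n) (m^2≡m*m (maxDeg G)) Δ²≤2n)))
  , deg-Tri-collision G 3≤n
  , λ d regular _ → regular-bounds G 3≤n d regular
  where
  deg≤Δ : ∀ u → deg G u ≤ maxDeg G
  deg≤Δ u = ≤-foldr-⊔ (deg G) 0 (∈-allFin u)
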